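{- For every positive integer $n$, the rational function $xF(n,x)+1$ has degree at most $-2$.
   Context: For a nonzero rational function $f(x)/g(x)$ with polynomials $f,g$, its degree is $\deg f-\deg g$. For a positive integer $m$, $A_m$ is the $m\times m$ matrix with $(i,j)$ entry $1$ if $i+j\le m+1$ and $0$ otherwise, and $u_m=(1,\dots,1)^T\in\mathbb{R}^m$. For $n\in\mathbb{N}$, $F(n,x)=1+\sum_{k\ge 0}\left(u_{n+1}^TA_{n+1}^k u_{n+1}\right)x^{k+1}$, which is a rational function of $x$. -}

module Defs where

open import Data.Nat as ℕ using (ℕ; zero; suc; _<ᵇ_)
open import Data.Bool using (if_then_else_)
open import Data.Fin using (Fin; toℕ)
open import Data.Integer as ℤ using (ℤ; +_; 0ℤ)
open import Data.List using (List; []; _∷_)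
open import Data.Product using (∃; _×_)
open import Relation.Binary.PropositionalEquality using (_≡_)
open import Relation.Nullary using (¬_)

ΣFin : (m : ℕ) → (Fin m → ℕ) → ℕ
ΣFin zero    f = 0
ΣFin (suc m) f = f Data.Fin.zero ℕ.+ ΣFin m (λ i → f (Data.Fin.suc i))

Mat : ℕ → Set
Mat m = Fin m → Fin m → ℕ

-- A_m : entry (i,j) (1-indexed) is 1 iff i + j ≤ m + 1.
-- With 0-indexed i j : Fin m this is (i+1)+(j+1) ≤ m+1, i.e. i + j < m.
A : (m : ℕ) → Mat m
A m i j = if (toℕ i ℕ.+ toℕ j) <ᵇ m then 1 else 0

idMat : (m : ℕ) → Mat m
idMat m i j = if (toℕ i ℕ.<ᵇ suc (toℕ j)) Data.Bool.∧ (toℕ j ℕ.<ᵇ suc (toℕ i)) then 1 else 0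

_⊗_ : {m : ℕ} → Mat m → Mat m → Mat m
_⊗_ {m} M N i j = ΣFin m (λ l → M i l ℕ.* N l j)

_^^_ : {m : ℕ} → Mat m → ℕ → Mat m
_^^_ {m} M zero    = idMat m
_^^_ {m} M (suc k) = M ⊗ (M ^^ k)

uᵀ_u : {m : ℕ} → Mat m → ℕ
uᵀ_u {m} M = ΣFin m (λ i → ΣFin m (λ j → M i j))

-- Coefficients of the power series F(n,x) = 1 + Σ_{k≥0} (u^T A^k u) x^{k+1},
-- with matrices of size n+1.
Fcoeff : ℕ → ℕ → ℤ
Fcoeff n zero    = + 1
Fcoeff n (suc k) = + (uᵀ_u (A (suc n) ^^ k))

-- Polynomials with integer coefficients as coefficient lists (constant term first)
Poly : Set
Poly = List ℤ

coeff : Poly → ℕ → ℤ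
coeff []       i       = 0ℤ
coeff (a ∷ p)  zero    = a
coeff (a ∷ p)  (suc i) = coeff p i

sumUpTo : ℕ → (ℕ → ℤ) → ℤ
sumUpTo zero    h = h 0
sumUpTo (suc k) h = sumUpTo k h ℤ.+ h (suc k)

convCoeff : Poly → (ℕ → ℤ) → ℕ → ℤ
convCoeff g c k = sumUpTo k (λ i → coeff g i ℤ.* c (k ℕ.∸ i))

NonZeroSeq : (ℕ → ℤ) → Set
NonZeroSeq a = ∃ λ i → ¬ (a i ≡ 0ℤ)

HasDegree : (ℕ → ℤ) → ℕ → Set
HasDegree a d = ¬ (a d ≡ 0ℤ) × (∀ i → d ℕ.< i → a i ≡ 0ℤ)

-- (f, g) represents the power series c as the rational function f/g:
-- g ≠ 0 and g · c = f as formal power series.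
Represents : Poly → Poly → (ℕ → ℤ) → Set
Represents f g c = NonZeroSeq (coeff g) × (∀ k → convCoeff g c k ≡ coeff f k)

xMulAdd : Poly → Poly → ℕ → ℤ
xMulAdd f g zero    = coeff g 0
xMulAdd f g (suc i) = coeff f i ℤ.+ coeff g (suc i)

-- Let e₀, …, eₙ be the unit vectors and u = A e₀ the all-ones vector, so the coefficients
-- of F(n,x) are the moments uᵀAᵏe₀.  For w₀ = e₀ − e₁ one has A w₀ = eₙ and A² w₀ = e₀,
-- hence the moments of w₀ form the series E = x + x²F = x(xF + 1).  The identity
-- A eᵦ = A eᵦ₊₁ + eₙ₋ᵦ expresses the vectors of the walk e₀, eₙ, e₁, eₙ₋₁, … as polynomials
-- in A applied to e₀; where the walk repeats a vector this gives q with q(A)e₀ = 0 and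
-- q(0) = ±1, and since A is injective also q(A)w₀ = 0.  So the coefficients of F and of E
-- both satisfy the linear recurrence q.  The first fact makes F rational, with the reversal
-- of q as denominator.  For any g·F = f, the polynomial g·E = x(xf + g) satisfies the
-- recurrence from deg g on; as q(0) ≠ 0 the recurrence runs backwards, so g·E vanishes from
-- degree deg g on, i.e. deg(xf + g) ≤ deg g − 2.

module Submission where

open import Defs
open import Data.Nat using (ℕ; _+_; _≤_; _<_)
open import Data.Product using (∃₂; _×_)

open import Data.Nat as ℕ using (zero; suc; _∸_; z≤n; s≤s; _≤?_)
import Data.Nat.Properties as ℕₚ
open import Data.Integer as ℤ using (ℤ; +_; 0ℤ; 1ℤ; -_; _-_) renaming (_+_ to _+ᶻ_; _*_ to _*ᶻ_)
import Data.Integer.Properties as ℤₚ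
open import Data.List using (List; []; _∷_; length; map)
open import Data.Product using (_,_; ∃; proj₁; proj₂)
open import Data.Sum using (_⊎_; inj₁; inj₂; [_,_]′)
open import Data.Empty using (⊥-elim)
open import Data.Bool using (Bool; true; false; if_then_else_)
open import Data.Fin as Fin using (Fin; toℕ; fromℕ<)
import Data.Fin.Properties as Finₚ
open import Function using (_∘_; const)
open import Relation.Nullary using (¬_; yes; no)
open import Relation.Binary.PropositionalEquality
open ≡-Reasoning
open import Algebra.Properties.CommutativeSemigroup ℤₚ.+-commutativeSemigroup
  using () renaming (interchange to +-interchange)
open import Algebra.Properties.CommutativeSemigroup ℤₚ.*-commutativeSemigroup
  using () renaming (x∙yz≈y∙xz to *-exchange)
open import Algebra.Properties.Semiring.Sum ℕₚ.+-*-semiring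
  using (sum; ∑-comm; sum-cong-≗; *-distribˡ-sum; sum-replicate-zero)
open import Algebra.Properties.AbelianGroup ℤₚ.+-0-abelianGroup using (xyx⁻¹≈y)

Σ< : ℕ → (ℕ → ℤ) → ℤ
Σ< zero    f = 0ℤ
Σ< (suc k) f = Σ< k f +ᶻ f k

Σ<-cong : ∀ k {f g : ℕ → ℤ} → (∀ j → j < k → f j ≡ g j) → Σ< k f ≡ Σ< k g
Σ<-cong zero    eq = refl
Σ<-cong (suc k) eq = cong₂ _+ᶻ_ (Σ<-cong k (λ j j<k → eq j (ℕₚ.m<n⇒m<1+n j<k))) (eq k ℕₚ.≤-refl)

Σ<-vanish : ∀ k {f : ℕ → ℤ} → (∀ j → j < k → f j ≡ 0ℤ) → Σ< k f ≡ 0ℤ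
Σ<-vanish zero    eq = refl
Σ<-vanish (suc k) eq = cong₂ _+ᶻ_ (Σ<-vanish k (λ j j<k → eq j (ℕₚ.m<n⇒m<1+n j<k))) (eq k ℕₚ.≤-refl)

Σ<-distrib-+ : ∀ k (f g : ℕ → ℤ) → Σ< k (λ j → f j +ᶻ g j) ≡ Σ< k f +ᶻ Σ< k g
Σ<-distrib-+ zero    f g = refl
Σ<-distrib-+ (suc k) f g = trans (cong (_+ᶻ (f k +ᶻ g k)) (Σ<-distrib-+ k f g))
  (+-interchange (Σ< k f) (Σ< k g) (f k) (g k))

Σ<-neg : ∀ k (f : ℕ → ℤ) → Σ< k (λ j → - f j) ≡ - Σ< k f
Σ<-neg zero    f = refl
Σ<-neg (suc k) f = trans (cong (_+ᶻ - f k) (Σ<-neg k f)) (sym (ℤₚ.neg-distrib-+ (Σ< k f) (f k)))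

Σ<-*ˡ : ∀ k c (f : ℕ → ℤ) → Σ< k (λ j → c *ᶻ f j) ≡ c *ᶻ Σ< k f
Σ<-*ˡ zero    c f = sym (ℤₚ.*-zeroʳ c)
Σ<-*ˡ (suc k) c f = trans (cong (_+ᶻ c *ᶻ f k) (Σ<-*ˡ k c f)) (sym (ℤₚ.*-distribˡ-+ c (Σ< k f) (f k)))

Σ<-head : ∀ k (f : ℕ → ℤ) → Σ< (suc k) f ≡ f 0 +ᶻ Σ< k (f ∘ suc)
Σ<-head zero    f = trans (ℤₚ.+-identityˡ (f 0)) (sym (ℤₚ.+-identityʳ (f 0)))
Σ<-head (suc k) f = trans (cong (_+ᶻ f (suc k)) (Σ<-head k f)) (ℤₚ.+-assoc (f 0) _ _)

Σ<-reverse : ∀ k (f : ℕ → ℤ) → Σ< (suc k) f ≡ Σ< (suc k) (λ i → f (k ∸ i))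
Σ<-reverse zero    f = refl
Σ<-reverse (suc k) f = begin
  Σ< (suc k) f +ᶻ f (suc k)                    ≡⟨ cong (_+ᶻ f (suc k)) (Σ<-reverse k f) ⟩
  Σ< (suc k) (λ i → f (k ∸ i)) +ᶻ f (suc k)    ≡⟨ ℤₚ.+-comm _ (f (suc k)) ⟩
  f (suc k) +ᶻ Σ< (suc k) (λ i → f (k ∸ i))    ≡⟨ Σ<-head (suc k) (λ i → f (suc k ∸ i)) ⟨
  Σ< (suc (suc k)) (λ i → f (suc k ∸ i))       ∎

Σ<-truncate : ∀ D t (f : ℕ → ℤ) → (∀ i → D ≤ i → f i ≡ 0ℤ) → Σ< (D + t) f ≡ Σ< D f
Σ<-truncate D zero    f vanish = cong (λ k → Σ< k f) (ℕₚ.+-identityʳ D)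
Σ<-truncate D (suc t) f vanish = begin
  Σ< (D + suc t) f
    ≡⟨ cong (λ k → Σ< k f) (ℕₚ.+-suc D t) ⟩
  Σ< (D + t) f +ᶻ f (D + t)
    ≡⟨ cong₂ _+ᶻ_ (Σ<-truncate D t f vanish) (vanish (D + t) (ℕₚ.m≤m+n D t)) ⟩
  Σ< D f +ᶻ 0ℤ
    ≡⟨ ℤₚ.+-identityʳ (Σ< D f) ⟩
  Σ< D f ∎

Σ<-comm : ∀ a b (H : ℕ → ℕ → ℤ) → Σ< a (λ l → Σ< b (λ i → H i l)) ≡ Σ< b (λ i → Σ< a (H i))
Σ<-comm a zero    H = Σ<-vanish a (λ _ _ → refl)
Σ<-comm a (suc b) H = trans (Σ<-distrib-+ a (λ l → Σ< b (λ i → H i l)) (H b))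
  (cong (_+ᶻ Σ< a (H b)) (Σ<-comm a b H))

sumUpTo≡Σ< : ∀ k (h : ℕ → ℤ) → sumUpTo k h ≡ Σ< (suc k) h
sumUpTo≡Σ< zero    h = sym (ℤₚ.+-identityˡ (h 0))
sumUpTo≡Σ< (suc k) h = cong (_+ᶻ h (suc k)) (sumUpTo≡Σ< k h)

δ : ℕ → ℕ → ℤ
δ zero    zero    = 1ℤ
δ zero    (suc i) = 0ℤ
δ (suc b) zero    = 0ℤ
δ (suc b) (suc i) = δ b i

δ-same : ∀ b → δ b b ≡ 1ℤ
δ-same zero    = refl
δ-same (suc b) = δ-same b

δ-diff : ∀ {b i} → b ≢ i → δ b i ≡ 0ℤ
δ-diff {zero}  {zero}  b≢i = ⊥-elim (b≢i refl)
δ-diff {zero}  {suc i} _   = refl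
δ-diff {suc b} {zero}  _   = refl
δ-diff {suc b} {suc i} b≢i = δ-diff (b≢i ∘ cong suc)

Σ<-δ-suc : ∀ b k → Σ< (suc k) (δ (suc b)) ≡ Σ< k (δ b)
Σ<-δ-suc b k = trans (Σ<-head k (δ (suc b))) (ℤₚ.+-identityˡ _)

Σ<-δ : ∀ {b k} → b < k → Σ< k (δ b) ≡ 1ℤ
Σ<-δ {zero}  {suc k} _         = trans (Σ<-head k (δ 0)) (cong (1ℤ +ᶻ_) (Σ<-vanish k (λ _ _ → refl)))
Σ<-δ {suc b} {suc k} (s≤s b<k) = trans (Σ<-δ-suc b k) (Σ<-δ b<k)

Σ<-δ-out : ∀ {b} k → k ≤ b → Σ< k (δ b) ≡ 0ℤ
Σ<-δ-out k k≤b = Σ<-vanish k (λ j j<k → δ-diff (λ b≡j → ℕₚ.<⇒≢ (ℕₚ.<-≤-trans j<k k≤b) (sym b≡j)))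

-- Linear recurrences and rational series

truncate : ℕ → (ℕ → ℤ) → Poly
truncate zero    r = r 0 ∷ []
truncate (suc M) r = r 0 ∷ truncate M (r ∘ suc)

coeff-truncate-≤ : ∀ M r i → i ≤ M → coeff (truncate M r) i ≡ r i
coeff-truncate-≤ zero    r zero    _         = refl
coeff-truncate-≤ (suc M) r zero    _         = refl
coeff-truncate-≤ (suc M) r (suc i) (s≤s i≤M) = coeff-truncate-≤ M (r ∘ suc) i i≤M

coeff-truncate-> : ∀ M r i → M < i → coeff (truncate M r) i ≡ 0ℤ
coeff-truncate-> zero    r (suc i) _         = refl
coeff-truncate-> (suc M) r (suc i) (s≤s M<i) = coeff-truncate-> M (r ∘ suc) i M<i

convCoeff-truncate : ∀ {g} D → (∀ i → D < i → coeff g i ≡ 0ℤ) → ∀ E k → D ≤ k →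
  convCoeff g E k ≡ Σ< (suc D) (λ i → coeff g i *ᶻ E (k ∸ i))
convCoeff-truncate {g} D high E k D≤k = begin
  sumUpTo k h
    ≡⟨ sumUpTo≡Σ< k h ⟩
  Σ< (suc k) h
    ≡⟨ cong (λ j → Σ< (suc j) h) (ℕₚ.m+[n∸m]≡n D≤k) ⟨
  Σ< (suc D + (k ∸ D)) h
    ≡⟨ Σ<-truncate (suc D) (k ∸ D) h (λ i D<i → cong (_*ᶻ E (k ∸ i)) (high i D<i)) ⟩
  Σ< (suc D) h ∎
  where
  h : ℕ → ℤ
  h i = coeff g i *ᶻ E (k ∸ i)

applyRec : List ℤ → (ℕ → ℤ) → ℕ → ℤ
applyRec q F s = Σ< (length q) (λ l → coeff q l *ᶻ F (s + l))

Annihilates : List ℤ → (ℕ → ℤ) → Set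
Annihilates q F = ∀ s → applyRec q F s ≡ 0ℤ

applyRec-∷ : ∀ a q (F : ℕ → ℤ) s → applyRec (a ∷ q) F s ≡ a *ᶻ F s +ᶻ applyRec q F (suc s)
applyRec-∷ a q F s = trans (Σ<-head (length q) _)
  (cong₂ (λ x y → a *ᶻ F x +ᶻ y) (ℕₚ.+-identityʳ s)
         (Σ<-cong (length q) (λ l _ → cong (λ x → coeff q l *ᶻ F x) (ℕₚ.+-suc s l))))

applyRec-vanish : ∀ q s {F : ℕ → ℤ} → (∀ l → F (s + l) ≡ 0ℤ) → applyRec q F s ≡ 0ℤ
applyRec-vanish q s vanish =
  Σ<-vanish (length q) (λ l _ → trans (cong (coeff q l *ᶻ_) (vanish l)) (ℤₚ.*-zeroʳ (coeff q l)))

Annihilates-resp : ∀ q {F G : ℕ → ℤ} → F ≗ G → Annihilates q F → Annihilates q G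
Annihilates-resp q F≗G rec s =
  trans (Σ<-cong (length q) (λ l _ → cong (coeff q l *ᶻ_) (sym (F≗G (s + l))))) (rec s)

Annihilates-convCoeff : ∀ q {E} {g} D → Annihilates q E → (∀ i → D < i → coeff g i ≡ 0ℤ) →
  ∀ s → D ≤ s → applyRec q (convCoeff g E) s ≡ 0ℤ
Annihilates-convCoeff q {E} {g} D rec high s D≤s = begin
  Σ< L (λ l → coeff q l *ᶻ convCoeff g E (s + l))
    ≡⟨ Σ<-cong L (λ l _ → cong (coeff q l *ᶻ_)
         (convCoeff-truncate {g} D high E (s + l) (ℕₚ.≤-trans D≤s (ℕₚ.m≤m+n s l)))) ⟩
  Σ< L (λ l → coeff q l *ᶻ Σ< (suc D) (λ i → coeff g i *ᶻ E (s + l ∸ i)))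
    ≡⟨ Σ<-cong L (λ l _ → trans (sym (Σ<-*ˡ (suc D) (coeff q l) _))
         (Σ<-cong (suc D) (λ i i≤D → reorder l i (ℕₚ.≤-trans (ℕₚ.≤-pred i≤D) D≤s)))) ⟩
  Σ< L (λ l → Σ< (suc D) (λ i → coeff g i *ᶻ (coeff q l *ᶻ E (s ∸ i + l))))
    ≡⟨ Σ<-comm L (suc D) _ ⟩
  Σ< (suc D) (λ i → Σ< L (λ l → coeff g i *ᶻ (coeff q l *ᶻ E (s ∸ i + l))))
    ≡⟨ Σ<-vanish (suc D) (λ i _ → trans (Σ<-*ˡ L (coeff g i) _)
         (trans (cong (coeff g i *ᶻ_) (rec (s ∸ i))) (ℤₚ.*-zeroʳ (coeff g i)))) ⟩
  0ℤ ∎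
  where
  L : ℕ
  L = length q
  reorder : ∀ l i → i ≤ s →
    coeff q l *ᶻ (coeff g i *ᶻ E (s + l ∸ i)) ≡ coeff g i *ᶻ (coeff q l *ᶻ E (s ∸ i + l))
  reorder l i i≤s = trans (*-exchange (coeff q l) (coeff g i) _)
    (cong (λ x → coeff g i *ᶻ (coeff q l *ᶻ E x)) (ℕₚ.+-∸-comm l i≤s))

-- The lowest coefficient of q being nonzero, the recurrence determines W t from the later
-- values, so vanishing beyond T propagates down to D.
vanish-backward : ∀ q {W : ℕ → ℤ} D T → coeff q 0 ≢ 0ℤ →
  (∀ s → D ≤ s → applyRec q W s ≡ 0ℤ) → (∀ t → T < t → W t ≡ 0ℤ) →
  ∀ t → D ≤ t → W t ≡ 0ℤ
vanish-backward []        D T q₀≢0 = ⊥-elim (q₀≢0 refl)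
vanish-backward (q₀ ∷ qs) {W} D T q₀≢0 rec beyondT t D≤t =
  descend (suc T) t D≤t (ℕₚ.m≤n+m (suc T) t)
  where
  descend : ∀ d t → D ≤ t → T < t + d → W t ≡ 0ℤ
  descend zero    t _   T<t = beyondT t (subst (T <_) (ℕₚ.+-identityʳ t) T<t)
  descend (suc d) t D≤t T<t+d with ℤₚ.i*j≡0⇒i≡0∨j≡0 q₀ q₀Wt≡0
    where
    later : applyRec qs W (suc t) ≡ 0ℤ
    later = applyRec-vanish qs (suc t) {W} (λ l → descend d (suc t + l)
      (ℕₚ.≤-trans D≤t (ℕₚ.≤-trans (ℕₚ.n≤1+n t) (ℕₚ.m≤m+n (suc t) l)))
      (ℕₚ.<-≤-trans (subst (T <_) (ℕₚ.+-suc t d) T<t+d)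
                    (ℕₚ.+-monoˡ-≤ d (ℕₚ.m≤m+n (suc t) l))))
    q₀Wt≡0 : q₀ *ᶻ W t ≡ 0ℤ
    q₀Wt≡0 = begin
      q₀ *ᶻ W t                              ≡⟨ ℤₚ.+-identityʳ _ ⟨
      q₀ *ᶻ W t +ᶻ 0ℤ                        ≡⟨ cong (q₀ *ᶻ W t +ᶻ_) later ⟨
      q₀ *ᶻ W t +ᶻ applyRec qs W (suc t)     ≡⟨ applyRec-∷ q₀ qs W t ⟨
      applyRec (q₀ ∷ qs) W t                 ≡⟨ rec t D≤t ⟩
      0ℤ                                     ∎
  ... | inj₁ q₀≡0  = ⊥-elim (q₀≢0 q₀≡0)
  ... | inj₂ Wt≡0 = Wt≡0

reversal : ℤ → List ℤ → Poly
reversal q₀ qs = truncate (length qs) (λ i → coeff (q₀ ∷ qs) (length qs ∸ i))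

coeff-reversal : ∀ q₀ qs l → l ≤ length qs → coeff (reversal q₀ qs) (length qs ∸ l) ≡ coeff (q₀ ∷ qs) l
coeff-reversal q₀ qs l l≤M = trans (coeff-truncate-≤ (length qs) _ (length qs ∸ l) (ℕₚ.m∸n≤m (length qs) l))
                                   (cong (coeff (q₀ ∷ qs)) (ℕₚ.m∸[m∸n]≡n l≤M))

convCoeff-reversal : ∀ q₀ qs c t → convCoeff (reversal q₀ qs) c (length qs + t) ≡ applyRec (q₀ ∷ qs) c t
convCoeff-reversal q₀ qs c t = begin
  convCoeff g c (M + t)
    ≡⟨ convCoeff-truncate {g} M (coeff-truncate-> M _) c (M + t) (ℕₚ.m≤m+n M t) ⟩
  Σ< (suc M) (λ i → coeff g i *ᶻ c (M + t ∸ i))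
    ≡⟨ Σ<-reverse M _ ⟩
  Σ< (suc M) (λ l → coeff g (M ∸ l) *ᶻ c (M + t ∸ (M ∸ l)))
    ≡⟨ Σ<-cong (suc M) (λ l l<1+M → let l≤M = ℕₚ.≤-pred l<1+M in
         cong₂ _*ᶻ_ (coeff-reversal q₀ qs l l≤M) (cong c (M+t∸[M∸l] l≤M))) ⟩
  applyRec (q₀ ∷ qs) c t ∎
  where
  M : ℕ
  M = length qs
  g : Poly
  g = reversal q₀ qs
  M+t∸[M∸l] : ∀ {l} → l ≤ M → M + t ∸ (M ∸ l) ≡ t + l
  M+t∸[M∸l] {l} l≤M = begin
    M + t ∸ (M ∸ l)     ≡⟨ ℕₚ.+-∸-comm t (ℕₚ.m∸n≤m M l) ⟩
    M ∸ (M ∸ l) + t     ≡⟨ cong (_+ t) (ℕₚ.m∸[m∸n]≡n l≤M) ⟩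
    l + t               ≡⟨ ℕₚ.+-comm l t ⟩
    t + l               ∎

rational-of-recurrence : ∀ q {c} → coeff q 0 ≢ 0ℤ → Annihilates q c → ∃₂ λ f g → Represents f g c
rational-of-recurrence []        q₀≢0 _ = ⊥-elim (q₀≢0 refl)
rational-of-recurrence (q₀ ∷ qs) {c} q₀≢0 rec = f , g , (M , gM≢0) , represents
  where
  M : ℕ
  M = length qs
  g f : Poly
  g = reversal q₀ qs
  f = truncate M (convCoeff g c)

  gM≢0 : coeff g M ≢ 0ℤ
  gM≢0 gM≡0 = q₀≢0 (trans (sym (coeff-reversal q₀ qs 0 z≤n)) gM≡0)

  represents : ∀ k → convCoeff g c k ≡ coeff f k
  represents k with k ≤? M
  ... | yes k≤M = sym (coeff-truncate-≤ M _ k k≤M)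
  ... | no  k≰M = begin
    convCoeff g c k              ≡⟨ cong (convCoeff g c) (ℕₚ.m+[n∸m]≡n M≤k) ⟨
    convCoeff g c (M + (k ∸ M))  ≡⟨ convCoeff-reversal q₀ qs c (k ∸ M) ⟩
    applyRec (q₀ ∷ qs) c (k ∸ M) ≡⟨ rec (k ∸ M) ⟩
    0ℤ                           ≡⟨ coeff-truncate-> M _ k (ℕₚ.≰⇒> k≰M) ⟨
    coeff f k                    ∎
    where
    M≤k : M ≤ k
    M≤k = ℕₚ.<⇒≤ (ℕₚ.≰⇒> k≰M)

-- E is the series x + x²c, so that g·c = f makes g·E = x(xf + g).
module ShiftedSeries (c E : ℕ → ℤ) (E₀ : E 0 ≡ 0ℤ) (E₁ : E 1 ≡ 1ℤ)
                     (c≡E : ∀ k → c k ≡ E (2 + k)) where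

  convCoeff-E-one : ∀ g → convCoeff g E 1 ≡ coeff g 0
  convCoeff-E-one g = begin
    coeff g 0 *ᶻ E 1 +ᶻ coeff g 1 *ᶻ E 0
      ≡⟨ cong₂ (λ x y → coeff g 0 *ᶻ x +ᶻ coeff g 1 *ᶻ y) E₁ E₀ ⟩
    coeff g 0 *ᶻ 1ℤ +ᶻ coeff g 1 *ᶻ 0ℤ
      ≡⟨ cong₂ _+ᶻ_ (ℤₚ.*-identityʳ (coeff g 0)) (ℤₚ.*-zeroʳ (coeff g 1)) ⟩
    coeff g 0 +ᶻ 0ℤ
      ≡⟨ ℤₚ.+-identityʳ (coeff g 0) ⟩
    coeff g 0 ∎

  convCoeff-E-suc : ∀ g j → convCoeff g E (2 + j) ≡ convCoeff g c j +ᶻ coeff g (suc j)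
  convCoeff-E-suc g j = begin
    sumUpTo j h +ᶻ coeff g (suc j) *ᶻ E (suc j ∸ j) +ᶻ coeff g (2 + j) *ᶻ E (j ∸ j)
      ≡⟨ cong₂ _+ᶻ_ (cong₂ _+ᶻ_ shift (cong (λ x → coeff g (suc j) *ᶻ E x) (ℕₚ.m+n∸n≡m 1 j)))
                    (cong (λ x → coeff g (2 + j) *ᶻ E x) (ℕₚ.n∸n≡0 j)) ⟩
    convCoeff g c j +ᶻ coeff g (suc j) *ᶻ E 1 +ᶻ coeff g (2 + j) *ᶻ E 0
      ≡⟨ cong₂ (λ x y → convCoeff g c j +ᶻ coeff g (suc j) *ᶻ x +ᶻ coeff g (2 + j) *ᶻ y) E₁ E₀ ⟩
    convCoeff g c j +ᶻ coeff g (suc j) *ᶻ 1ℤ +ᶻ coeff g (2 + j) *ᶻ 0ℤ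
      ≡⟨ cong₂ (λ x y → convCoeff g c j +ᶻ x +ᶻ y) (ℤₚ.*-identityʳ _) (ℤₚ.*-zeroʳ (coeff g (2 + j))) ⟩
    convCoeff g c j +ᶻ coeff g (suc j) +ᶻ 0ℤ
      ≡⟨ ℤₚ.+-identityʳ _ ⟩
    convCoeff g c j +ᶻ coeff g (suc j) ∎
    where
    h : ℕ → ℤ
    h i = coeff g i *ᶻ E (2 + j ∸ i)
    shift : sumUpTo j h ≡ convCoeff g c j
    shift = begin
      sumUpTo j h             ≡⟨ sumUpTo≡Σ< j h ⟩
      Σ< (suc j) h            ≡⟨ Σ<-cong (suc j) (λ i i<1+j → cong (coeff g i *ᶻ_)
                                   (trans (cong E (ℕₚ.+-∸-assoc 2 (ℕₚ.≤-pred i<1+j))) (sym (c≡E (j ∸ i))))) ⟩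
      Σ< (suc j) (λ i → coeff g i *ᶻ c (j ∸ i)) ≡⟨ sumUpTo≡Σ< j _ ⟨
      convCoeff g c j         ∎

  xMulAdd≡convCoeff-E : ∀ f g → (∀ k → convCoeff g c k ≡ coeff f k) →
    ∀ j → xMulAdd f g j ≡ convCoeff g E (suc j)
  xMulAdd≡convCoeff-E f g conv zero    = sym (convCoeff-E-one g)
  xMulAdd≡convCoeff-E f g conv (suc j) =
    sym (trans (convCoeff-E-suc g j) (cong (_+ᶻ coeff g (suc j)) (conv j)))

  convCoeff-E-lowest : ∀ g j → (∀ l → l < j → coeff g l ≡ 0ℤ) → convCoeff g E (suc j) ≡ coeff g j
  convCoeff-E-lowest g zero    _     = convCoeff-E-one g
  convCoeff-E-lowest g (suc j) below = begin
    convCoeff g E (2 + j)              ≡⟨ convCoeff-E-suc g j ⟩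
    convCoeff g c j +ᶻ coeff g (suc j) ≡⟨ cong (_+ᶻ coeff g (suc j)) low ⟩
    0ℤ +ᶻ coeff g (suc j)              ≡⟨ ℤₚ.+-identityˡ _ ⟩
    coeff g (suc j)                    ∎
    where
    low : convCoeff g c j ≡ 0ℤ
    low = trans (sumUpTo≡Σ< j _)
      (Σ<-vanish (suc j) (λ l l<1+j → cong (_*ᶻ c (j ∸ l)) (below l l<1+j)))

  low-coeffs-vanish : ∀ g i → (∀ j → j < i → convCoeff g E (suc j) ≡ 0ℤ) → ∀ j → j < i → coeff g j ≡ 0ℤ
  low-coeffs-vanish g (suc i) vanish j j<1+i =
    [ below j , (λ j≡i → subst (λ x → coeff g x ≡ 0ℤ) (sym j≡i) gi≡0) ]′
      (ℕₚ.m≤n⇒m<n∨m≡n (ℕₚ.≤-pred j<1+i))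
    where
    below : ∀ j → j < i → coeff g j ≡ 0ℤ
    below = low-coeffs-vanish g i (λ j j<i → vanish j (ℕₚ.m<n⇒m<1+n j<i))
    gi≡0 : coeff g i ≡ 0ℤ
    gi≡0 = trans (sym (convCoeff-E-lowest g i below)) (vanish i ℕₚ.≤-refl)

  xMulAdd-nonzero : ∀ f g → (∀ k → convCoeff g c k ≡ coeff f k) →
    NonZeroSeq (coeff g) → NonZeroSeq (xMulAdd f g)
  xMulAdd-nonzero f g conv (i , gi≢0)
    with Finₚ.¬∀⟶∃¬ (suc i) (λ j → xMulAdd f g (toℕ j) ≡ 0ℤ) (λ j → xMulAdd f g (toℕ j) ℤ.≟ 0ℤ)
                    not-all-zero
    where
    not-all-zero : ¬ (∀ j → xMulAdd f g (toℕ j) ≡ 0ℤ)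
    not-all-zero all-zero = gi≢0 (low-coeffs-vanish g (suc i) conv-zero i ℕₚ.≤-refl)
      where
      conv-zero : ∀ j → j < suc i → convCoeff g E (suc j) ≡ 0ℤ
      conv-zero j j<1+i = trans (sym (xMulAdd≡convCoeff-E f g conv j))
        (subst (λ x → xMulAdd f g x ≡ 0ℤ) (Finₚ.toℕ-fromℕ< j<1+i) (all-zero (fromℕ< j<1+i)))
  ... | j , xj≢0 = toℕ j , xj≢0

  degree-gap : ∀ q → coeff q 0 ≢ 0ℤ → Annihilates q E →
    ∀ f g → (∀ k → convCoeff g c k ≡ coeff f k) →
    ∀ dg dh → HasDegree (coeff g) dg → HasDegree (xMulAdd f g) dh → dh + 2 ≤ dg
  degree-gap q q₀≢0 rec f g conv dg dh (_ , g-high) (xdh≢0 , x-high) with dg ≤? suc dh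
  ... | no  dg≰1+dh = subst (_≤ dg) (ℕₚ.+-comm 2 dh) (ℕₚ.≰⇒> dg≰1+dh)
  ... | yes dg≤1+dh = ⊥-elim (xdh≢0 (trans (xMulAdd≡convCoeff-E f g conv dh) (vanish (suc dh) dg≤1+dh)))
    where
    beyond : ∀ t → suc dh < t → convCoeff g E t ≡ 0ℤ
    beyond (suc t) (s≤s dh<t) = trans (sym (xMulAdd≡convCoeff-E f g conv t)) (x-high t dh<t)
    vanish : ∀ t → dg ≤ t → convCoeff g E t ≡ 0ℤ
    vanish = vanish-backward q dg (suc dh) q₀≢0 (Annihilates-convCoeff q {E} {g} dg rec g-high) beyond

infixl 6 _⊞_
_⊞_ : List ℤ → List ℤ → List ℤ
[]      ⊞ q       = q
(a ∷ p) ⊞ []      = a ∷ p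
(a ∷ p) ⊞ (b ∷ q) = a +ᶻ b ∷ p ⊞ q

coeff-⊞ : ∀ p q i → coeff (p ⊞ q) i ≡ coeff p i +ᶻ coeff q i
coeff-⊞ []      q       i       = sym (ℤₚ.+-identityˡ _)
coeff-⊞ (a ∷ p) []      i       = sym (ℤₚ.+-identityʳ _)
coeff-⊞ (a ∷ p) (b ∷ q) zero    = refl
coeff-⊞ (a ∷ p) (b ∷ q) (suc i) = coeff-⊞ p q i

coeff-neg : ∀ p i → coeff (map -_ p) i ≡ - coeff p i
coeff-neg []      i       = refl
coeff-neg (a ∷ p) zero    = refl
coeff-neg (a ∷ p) (suc i) = coeff-neg p i

-- These mirror A eₐ₊₁ = A eₐ − eₙ₋ₐ and A eₙ₋ₐ₋₁ = A eₙ₋ₐ + eₐ₊₁ (see stage-suc).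
φᵉ φᵒ : ℕ → List ℤ
φᵉ zero    = 1ℤ ∷ []
φᵉ (suc a) = (0ℤ ∷ 0ℤ ∷ φᵉ a) ⊞ map -_ (φᵒ a)
φᵒ zero    = 1ℤ ∷ []
φᵒ (suc a) = (0ℤ ∷ 0ℤ ∷ φᵒ a) ⊞ φᵉ (suc a)

coeff-x²⊞ : ∀ p r → coeff ((0ℤ ∷ 0ℤ ∷ p) ⊞ r) 0 ≡ coeff r 0
coeff-x²⊞ p r = trans (coeff-⊞ (0ℤ ∷ 0ℤ ∷ p) r 0) (ℤₚ.+-identityˡ _)

φ-heads : ∀ a → ℤ.∣ coeff (φᵉ a) 0 ∣ ≡ 1 × ℤ.∣ coeff (φᵒ a) 0 ∣ ≡ 1
φ-heads zero    = refl , refl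
φ-heads (suc a) = even , trans (cong ℤ.∣_∣ (coeff-x²⊞ (φᵒ a) (φᵉ (suc a)))) even
  where
  even : ℤ.∣ coeff (φᵉ (suc a)) 0 ∣ ≡ 1
  even = begin
    ℤ.∣ coeff (φᵉ (suc a)) 0 ∣
      ≡⟨ cong ℤ.∣_∣ (trans (coeff-x²⊞ (φᵉ a) (map -_ (φᵒ a))) (coeff-neg (φᵒ a) 0)) ⟩
    ℤ.∣ - coeff (φᵒ a) 0 ∣            ≡⟨ ℤₚ.∣-i∣≡∣i∣ (coeff (φᵒ a) 0) ⟩
    ℤ.∣ coeff (φᵒ a) 0 ∣              ≡⟨ proj₂ (φ-heads a) ⟩
    1                                 ∎

nonzero-head : ∀ p p′ → ℤ.∣ coeff p′ 0 ∣ ≡ 1 → coeff ((0ℤ ∷ p) ⊞ map -_ p′) 0 ≢ 0ℤ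
nonzero-head p p′ ∣p′₀∣≡1 q₀≡0 = ℕₚ.0≢1+n (begin
  0                                      ≡⟨ cong ℤ.∣_∣ q₀≡0 ⟨
  ℤ.∣ coeff ((0ℤ ∷ p) ⊞ map -_ p′) 0 ∣   ≡⟨ cong ℤ.∣_∣ (trans (coeff-⊞ (0ℤ ∷ p) (map -_ p′) 0)
                                                         (ℤₚ.+-identityˡ (coeff (map -_ p′) 0))) ⟩
  ℤ.∣ coeff (map -_ p′) 0 ∣              ≡⟨ cong ℤ.∣_∣ (coeff-neg p′ 0) ⟩
  ℤ.∣ - coeff p′ 0 ∣                     ≡⟨ ℤₚ.∣-i∣≡∣i∣ (coeff p′ 0) ⟩
  ℤ.∣ coeff p′ 0 ∣                       ≡⟨ ∣p′₀∣≡1 ⟩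
  1                                      ∎)

+ΣFin≡Σ< : ∀ k (f : Fin k → ℕ) (F : ℕ → ℤ) → (∀ i → + f i ≡ F (toℕ i)) → + ΣFin k f ≡ Σ< k F
+ΣFin≡Σ< zero    f F f≡F = refl
+ΣFin≡Σ< (suc k) f F f≡F = begin
  + (f Fin.zero ℕ.+ ΣFin k (f ∘ Fin.suc))
    ≡⟨ ℤₚ.pos-+ (f Fin.zero) _ ⟩
  + f Fin.zero +ᶻ + ΣFin k (f ∘ Fin.suc)
    ≡⟨ cong₂ _+ᶻ_ (f≡F Fin.zero) (+ΣFin≡Σ< k (f ∘ Fin.suc) (F ∘ suc) (f≡F ∘ Fin.suc)) ⟩
  F 0 +ᶻ Σ< k (F ∘ suc)
    ≡⟨ Σ<-head k F ⟨
  Σ< (suc k) F ∎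

ΣFin≡sum : ∀ k (f : Fin k → ℕ) → ΣFin k f ≡ sum f
ΣFin≡sum zero    f = refl
ΣFin≡sum (suc k) f = cong (f Fin.zero ℕ.+_) (ΣFin≡sum k (f ∘ Fin.suc))

ΣFin-cong : ∀ {k} {f g : Fin k → ℕ} → (∀ i → f i ≡ g i) → ΣFin k f ≡ ΣFin k g
ΣFin-cong {zero}  f≡g = refl
ΣFin-cong {suc k} f≡g = cong₂ ℕ._+_ (f≡g Fin.zero) (ΣFin-cong (f≡g ∘ Fin.suc))

ΣFin-zero : ∀ k → ΣFin k (const 0) ≡ 0
ΣFin-zero k = trans (ΣFin≡sum k (const 0)) (sum-replicate-zero k)

ΣFin-*ˡ : ∀ k c (f : Fin k → ℕ) → ΣFin k (λ i → c ℕ.* f i) ≡ c ℕ.* ΣFin k f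
ΣFin-*ˡ k c f = begin
  ΣFin k (λ i → c ℕ.* f i)   ≡⟨ ΣFin≡sum k _ ⟩
  sum (λ i → c ℕ.* f i)      ≡⟨ *-distribˡ-sum c f ⟨
  c ℕ.* sum f                ≡⟨ cong (c ℕ.*_) (ΣFin≡sum k f) ⟨
  c ℕ.* ΣFin k f             ∎

ΣFin-comm : ∀ k (F : Fin k → Fin k → ℕ) →
  ΣFin k (λ j → ΣFin k (F j)) ≡ ΣFin k (λ l → ΣFin k (λ j → F j l))
ΣFin-comm k F = begin
  ΣFin k (λ j → ΣFin k (F j))           ≡⟨ ΣFin²≡sum² F ⟩
  sum (λ j → sum (F j))                 ≡⟨ ∑-comm F ⟩
  sum (λ l → sum (λ j → F j l))         ≡⟨ ΣFin²≡sum² (λ l j → F j l) ⟨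
  ΣFin k (λ l → ΣFin k (λ j → F j l))   ∎
  where
  ΣFin²≡sum² : ∀ (G : Fin k → Fin k → ℕ) → ΣFin k (λ j → ΣFin k (G j)) ≡ sum (λ j → sum (G j))
  ΣFin²≡sum² G = trans (ΣFin≡sum k _) (sum-cong-≗ (λ j → ΣFin≡sum k (G j)))

ΣFin-idMat : ∀ k (i : Fin k) → ΣFin k (idMat k i) ≡ 1
ΣFin-idMat (suc k) Fin.zero    = cong suc (ΣFin-zero k)
ΣFin-idMat (suc k) (Fin.suc i) = ΣFin-idMat k i

<ᵇ-true : ∀ {l T} → l < T → (l ℕ.<ᵇ T) ≡ true
<ᵇ-true {zero}  {suc T} _         = refl
<ᵇ-true {suc l} {suc T} (s≤s l<T) = <ᵇ-true l<T

<ᵇ-false : ∀ {l T} → T ≤ l → (l ℕ.<ᵇ T) ≡ false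
<ᵇ-false {l}     {zero}  _         = refl
<ᵇ-false {suc l} {suc T} (s≤s T≤l) = <ᵇ-false T≤l

+<ᵇ≡<ᵇ∸ : ∀ t l K → (t + l ℕ.<ᵇ K) ≡ (l ℕ.<ᵇ K ∸ t)
+<ᵇ≡<ᵇ∸ zero    l K       = refl
+<ᵇ≡<ᵇ∸ (suc t) l zero    = refl
+<ᵇ≡<ᵇ∸ (suc t) l (suc K) = +<ᵇ≡<ᵇ∸ t l K

Σ<-if-< : ∀ t K (h : ℕ → ℤ) → Σ< K (λ l → if t + l ℕ.<ᵇ K then h l else 0ℤ) ≡ Σ< (K ∸ t) h
Σ<-if-< t K h = begin
  Σ< K (λ l → keep (t + l ℕ.<ᵇ K) l)
    ≡⟨ Σ<-cong K (λ l _ → cong (λ b → keep b l) (+<ᵇ≡<ᵇ∸ t l K)) ⟩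
  Σ< K (λ l → keep (l ℕ.<ᵇ T) l)
    ≡⟨ cong (λ k → Σ< k (λ l → keep (l ℕ.<ᵇ T) l)) (ℕₚ.m+[n∸m]≡n (ℕₚ.m∸n≤m K t)) ⟨
  Σ< (T + (K ∸ T)) (λ l → keep (l ℕ.<ᵇ T) l)
    ≡⟨ Σ<-truncate T (K ∸ T) _ (λ l T≤l → cong (λ b → keep b l) (<ᵇ-false T≤l)) ⟩
  Σ< T (λ l → keep (l ℕ.<ᵇ T) l)
    ≡⟨ Σ<-cong T (λ l l<T → cong (λ b → keep b l) (<ᵇ-true l<T)) ⟩
  Σ< T h ∎
  where
  T : ℕ
  T = K ∸ t
  keep : Bool → ℕ → ℤ
  keep b l = if b then h l else 0ℤ

-- The matrix A acting on sequences

x+y-y≡x : ∀ x y → x +ᶻ y +ᶻ - y ≡ x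
x+y-y≡x x y = trans (ℤₚ.+-assoc x y (- y)) (trans (cong (x +ᶻ_) (ℤₚ.+-inverseʳ y)) (ℤₚ.+-identityʳ x))

parity : ∀ n → ∃ λ a → n ≡ a + a ⊎ n ≡ suc (a + a)
parity zero    = 0 , inj₁ refl
parity (suc n) with parity n
... | a , inj₁ n≡a+a   = a , inj₂ (cong suc n≡a+a)
... | a , inj₂ n≡1+a+a = suc a , inj₁ (cong suc (trans n≡1+a+a (sym (ℕₚ.+-suc a a))))

module Operator (n : ℕ) where

  m : ℕ
  m = suc n

  infix 4 _≈_
  _≈_ : (ℕ → ℤ) → (ℕ → ℤ) → Set
  v ≈ w = ∀ i → i < m → v i ≡ w i

  -- With 0-indexed entries Aᵢⱼ = 1 iff i + j < m, so (A w)ᵢ = Σ_{j < m ∸ i} wⱼ; a vector of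
  -- length m is a sequence read on its first m entries, and _≈_ compares those entries.
  A· : (ℕ → ℤ) → ℕ → ℤ
  A· w i = Σ< (m ∸ i) w

  A·-cong : ∀ {v w} → v ≈ w → ∀ i → A· v i ≡ A· w i
  A·-cong v≈w i = Σ<-cong (m ∸ i) (λ j j<m∸i → v≈w j (ℕₚ.<-≤-trans j<m∸i (ℕₚ.m∸n≤m m i)))

  A·-+ : ∀ v w i → A· (λ j → v j +ᶻ w j) i ≡ A· v i +ᶻ A· w i
  A·-+ v w i = Σ<-distrib-+ (m ∸ i) v w

  A·-neg : ∀ v i → A· (λ j → - v j) i ≡ - A· v i
  A·-neg v i = Σ<-neg (m ∸ i) v

  A·-* : ∀ a v i → A· (λ j → a *ᶻ v j) i ≡ a *ᶻ A· v i
  A·-* a v i = Σ<-*ˡ (m ∸ i) a v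

  A·-injective : ∀ {w} → A· w ≈ const 0ℤ → w ≈ const 0ℤ
  A·-injective {w} Aw≈0 j j<m = begin
    w j              ≡⟨ ℤₚ.+-identityˡ (w j) ⟨
    0ℤ +ᶻ w j        ≡⟨ cong (_+ᶻ w j) (prefix j (ℕₚ.<⇒≤ j<m)) ⟨
    Σ< (suc j) w     ≡⟨ prefix (suc j) j<m ⟩
    0ℤ               ∎
    where
    prefix : ∀ k → k ≤ m → Σ< k w ≡ 0ℤ
    prefix zero    _   = refl
    prefix (suc k) k<m = trans (cong (λ l → Σ< l w) (sym (ℕₚ.m∸[m∸n]≡n k<m)))
                               (Aw≈0 (m ∸ suc k) (s≤s (ℕₚ.m∸n≤m n k)))

  δ-flip : ∀ {b} → b ≤ n → ∀ i → δ (suc b) (m ∸ i) ≡ δ (n ∸ b) i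
  δ-flip {b} b≤n i with i ℕ.≟ n ∸ b
  ... | yes refl = trans (cong (δ (suc b)) m∸[n∸b]≡1+b) (trans (δ-same (suc b)) (sym (δ-same (n ∸ b))))
    where
    m∸[n∸b]≡1+b : m ∸ (n ∸ b) ≡ suc b
    m∸[n∸b]≡1+b = trans (ℕₚ.+-∸-assoc 1 (ℕₚ.m∸n≤m n b)) (cong suc (ℕₚ.m∸[m∸n]≡n b≤n))
  ... | no i≢n∸b = trans (δ-diff (i≢n∸b ∘ solve)) (sym (δ-diff (i≢n∸b ∘ sym)))
    where
    solve : suc b ≡ m ∸ i → i ≡ n ∸ b
    solve e = trans (sym (ℕₚ.m∸[m∸n]≡n i≤n)) (cong (n ∸_) (sym b≡n∸i))
      where
      i≤n : i ≤ n
      i≤n = ℕₚ.≤-pred (ℕₚ.m∸n≢0⇒n<m (λ m∸i≡0 → ℕₚ.1+n≢0 (trans e m∸i≡0)))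
      b≡n∸i : b ≡ n ∸ i
      b≡n∸i = ℕₚ.suc-injective (trans e (ℕₚ.+-∸-assoc 1 i≤n))

  A·δ-step : ∀ {b} → b ≤ n → ∀ i → A· (δ b) i ≡ A· (δ (suc b)) i +ᶻ δ (n ∸ b) i
  A·δ-step {b} b≤n i = begin
    Σ< (m ∸ i) (δ b)
      ≡⟨ Σ<-δ-suc b (m ∸ i) ⟨
    Σ< (m ∸ i) (δ (suc b)) +ᶻ δ (suc b) (m ∸ i)
      ≡⟨ cong (Σ< (m ∸ i) (δ (suc b)) +ᶻ_) (δ-flip b≤n i) ⟩
    Σ< (m ∸ i) (δ (suc b)) +ᶻ δ (n ∸ b) i ∎

  A·δ-n : ∀ i → A· (δ n) i ≡ δ 0 i
  A·δ-n i = begin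
    A· (δ n) i
      ≡⟨ A·δ-step ℕₚ.≤-refl i ⟩
    A· (δ m) i +ᶻ δ (n ∸ n) i
      ≡⟨ cong₂ _+ᶻ_ (Σ<-δ-out (m ∸ i) (ℕₚ.m∸n≤m m i)) (cong (λ b → δ b i) (ℕₚ.n∸n≡0 n)) ⟩
    0ℤ +ᶻ δ 0 i
      ≡⟨ ℤₚ.+-identityˡ _ ⟩
    δ 0 i ∎

  A·δ-0 : A· (δ 0) ≈ const 1ℤ
  A·δ-0 i i<m = Σ<-δ (ℕₚ.m<n⇒0<n∸m i<m)

  infix 8 _⟦A⟧_
  _⟦A⟧_ : List ℤ → (ℕ → ℤ) → ℕ → ℤ
  ([]      ⟦A⟧ w) i = 0ℤ
  ((a ∷ p) ⟦A⟧ w) i = a *ᶻ w i +ᶻ A· (p ⟦A⟧ w) i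

  ⟦A⟧-cong : ∀ p {v w} → v ≈ w → p ⟦A⟧ v ≈ p ⟦A⟧ w
  ⟦A⟧-cong []      v≈w i _   = refl
  ⟦A⟧-cong (a ∷ p) v≈w i i<m = cong₂ _+ᶻ_ (cong (a *ᶻ_) (v≈w i i<m)) (A·-cong (⟦A⟧-cong p v≈w) i)

  ⟦A⟧-one : ∀ w i → ((1ℤ ∷ []) ⟦A⟧ w) i ≡ w i
  ⟦A⟧-one w i = begin
    1ℤ *ᶻ w i +ᶻ A· (const 0ℤ) i   ≡⟨ cong (1ℤ *ᶻ w i +ᶻ_) (Σ<-vanish (m ∸ i) (λ _ _ → refl)) ⟩
    1ℤ *ᶻ w i +ᶻ 0ℤ                ≡⟨ ℤₚ.+-identityʳ _ ⟩
    1ℤ *ᶻ w i                      ≡⟨ ℤₚ.*-identityˡ (w i) ⟩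
    w i                            ∎

  ⟦A⟧-x : ∀ p w i → ((0ℤ ∷ p) ⟦A⟧ w) i ≡ A· (p ⟦A⟧ w) i
  ⟦A⟧-x p w i = ℤₚ.+-identityˡ _

  ⟦A⟧-⊞ : ∀ p q w i → ((p ⊞ q) ⟦A⟧ w) i ≡ (p ⟦A⟧ w) i +ᶻ (q ⟦A⟧ w) i
  ⟦A⟧-⊞ []      q       w i = sym (ℤₚ.+-identityˡ _)
  ⟦A⟧-⊞ (a ∷ p) []      w i = sym (ℤₚ.+-identityʳ _)
  ⟦A⟧-⊞ (a ∷ p) (b ∷ q) w i = begin
    (a +ᶻ b) *ᶻ w i +ᶻ A· ((p ⊞ q) ⟦A⟧ w) i
      ≡⟨ cong₂ _+ᶻ_ (ℤₚ.*-distribʳ-+ (w i) a b)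
                    (trans (A·-cong (λ j _ → ⟦A⟧-⊞ p q w j) i) (A·-+ (p ⟦A⟧ w) (q ⟦A⟧ w) i)) ⟩
    (a *ᶻ w i +ᶻ b *ᶻ w i) +ᶻ (A· (p ⟦A⟧ w) i +ᶻ A· (q ⟦A⟧ w) i)
      ≡⟨ +-interchange (a *ᶻ w i) _ _ _ ⟩
    (a *ᶻ w i +ᶻ A· (p ⟦A⟧ w) i) +ᶻ (b *ᶻ w i +ᶻ A· (q ⟦A⟧ w) i) ∎

  ⟦A⟧-neg : ∀ p w i → (map -_ p ⟦A⟧ w) i ≡ - (p ⟦A⟧ w) i
  ⟦A⟧-neg []      w i = refl
  ⟦A⟧-neg (a ∷ p) w i = begin
    - a *ᶻ w i +ᶻ A· (map -_ p ⟦A⟧ w) i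
      ≡⟨ cong₂ _+ᶻ_ (sym (ℤₚ.neg-distribˡ-* a (w i)))
                    (trans (A·-cong (λ j _ → ⟦A⟧-neg p w j) i) (A·-neg (p ⟦A⟧ w) i)) ⟩
    - (a *ᶻ w i) +ᶻ - A· (p ⟦A⟧ w) i
      ≡⟨ ℤₚ.neg-distrib-+ (a *ᶻ w i) _ ⟨
    - (a *ᶻ w i +ᶻ A· (p ⟦A⟧ w) i) ∎

  ⟦A⟧-A· : ∀ p w i → (p ⟦A⟧ A· w) i ≡ A· (p ⟦A⟧ w) i
  ⟦A⟧-A· []      w i = sym (Σ<-vanish (m ∸ i) (λ _ _ → refl))
  ⟦A⟧-A· (a ∷ p) w i = begin
    a *ᶻ A· w i +ᶻ A· (p ⟦A⟧ A· w) i
      ≡⟨ cong₂ _+ᶻ_ (sym (A·-* a w i)) (A·-cong (λ j _ → ⟦A⟧-A· p w j) i) ⟩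
    A· (λ j → a *ᶻ w j) i +ᶻ A· (A· (p ⟦A⟧ w)) i
      ≡⟨ A·-+ (λ j → a *ᶻ w j) (A· (p ⟦A⟧ w)) i ⟨
    A· ((a ∷ p) ⟦A⟧ w) i ∎

  A^ : ℕ → (ℕ → ℤ) → ℕ → ℤ
  A^ zero    w = w
  A^ (suc k) w = A· (A^ k w)

  A^-cong : ∀ k {v w} → v ≈ w → A^ k v ≈ A^ k w
  A^-cong zero    v≈w = v≈w
  A^-cong (suc k) v≈w i _ = A·-cong (A^-cong k v≈w) i

  A^-+ : ∀ k v w i → A^ k (λ j → v j +ᶻ w j) i ≡ A^ k v i +ᶻ A^ k w i
  A^-+ zero    v w i = refl
  A^-+ (suc k) v w i = trans (A·-cong (λ j _ → A^-+ k v w j) i) (A·-+ (A^ k v) (A^ k w) i)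

  A^-neg : ∀ k v i → A^ k (λ j → - v j) i ≡ - A^ k v i
  A^-neg zero    v i = refl
  A^-neg (suc k) v i = trans (A·-cong (λ j _ → A^-neg k v j) i) (A·-neg (A^ k v) i)

  A^-suc : ∀ k w i → A^ (suc k) w i ≡ A^ k (A· w) i
  A^-suc zero    w i = refl
  A^-suc (suc k) w i = A·-cong (λ j _ → A^-suc k w j) i

  A^-⟦A⟧ : ∀ p k w i → (p ⟦A⟧ A^ k w) i ≡ A^ k (p ⟦A⟧ w) i
  A^-⟦A⟧ p zero    w i = refl
  A^-⟦A⟧ p (suc k) w i = trans (⟦A⟧-A· p (A^ k w) i) (A·-cong (λ j _ → A^-⟦A⟧ p k w j) i)

  A^-vanish : ∀ k {v} → v ≈ const 0ℤ → A^ k v ≈ const 0ℤ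
  A^-vanish zero    v≈0 = v≈0
  A^-vanish (suc k) v≈0 i i<m = trans (A·-cong (A^-vanish k v≈0) i) (Σ<-vanish (m ∸ i) (λ _ _ → refl))

  Reaches : ℕ → (ℕ → ℤ) → List ℤ → Set
  Reaches k x p = A^ k x ≈ p ⟦A⟧ δ 0

  Reaches-neg : ∀ {k x p} → Reaches k x p → Reaches k (λ j → - x j) (map -_ p)
  Reaches-neg {k} {x} {p} reach i i<m =
    trans (A^-neg k x i) (trans (cong -_ (reach i i<m)) (sym (⟦A⟧-neg p (δ 0) i)))

  Reaches-step : ∀ {k x y z p r} → (∀ i → A· x i ≡ A· y i +ᶻ z i) →
    Reaches k y p → Reaches (suc k) z r → Reaches (2 + k) x ((0ℤ ∷ 0ℤ ∷ p) ⊞ r)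
  Reaches-step {k} {x} {y} {z} {p} {r} Ax≡Ay+z reach-y reach-z i i<m = begin
    A^ (2 + k) x i
      ≡⟨ A^-suc (suc k) x i ⟩
    A^ (suc k) (A· x) i
      ≡⟨ A^-cong (suc k) (λ j _ → Ax≡Ay+z j) i i<m ⟩
    A^ (suc k) (λ j → A· y j +ᶻ z j) i
      ≡⟨ A^-+ (suc k) (A· y) z i ⟩
    A^ (suc k) (A· y) i +ᶻ A^ (suc k) z i
      ≡⟨ cong (_+ᶻ A^ (suc k) z i) (A^-suc (suc k) y i) ⟨
    A· (A· (A^ k y)) i +ᶻ A^ (suc k) z i
      ≡⟨ cong₂ _+ᶻ_ (A·-cong (λ j _ → A·-cong reach-y j) i) (reach-z i i<m) ⟩
    A· (A· (p ⟦A⟧ e₀)) i +ᶻ (r ⟦A⟧ e₀) i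
      ≡⟨ cong (_+ᶻ (r ⟦A⟧ e₀) i) x²p ⟨
    ((0ℤ ∷ 0ℤ ∷ p) ⟦A⟧ e₀) i +ᶻ (r ⟦A⟧ e₀) i
      ≡⟨ ⟦A⟧-⊞ (0ℤ ∷ 0ℤ ∷ p) r e₀ i ⟨
    (((0ℤ ∷ 0ℤ ∷ p) ⊞ r) ⟦A⟧ e₀) i ∎
    where
    e₀ : ℕ → ℤ
    e₀ = δ 0
    x²p : ((0ℤ ∷ 0ℤ ∷ p) ⟦A⟧ e₀) i ≡ A· (A· (p ⟦A⟧ e₀)) i
    x²p = trans (⟦A⟧-x (0ℤ ∷ p) e₀ i) (A·-cong (λ j _ → ⟦A⟧-x p e₀ j) i)

  Stage : ℕ → ℕ → Set
  Stage k a = Reaches k (δ a) (φᵉ a) × Reaches (suc k) (δ (n ∸ a)) (φᵒ a)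

  stage-zero : Stage 0 0
  stage-zero = (λ i _ → sym (⟦A⟧-one (δ 0) i)) , (λ i _ → trans (A·δ-n i) (sym (⟦A⟧-one (δ 0) i)))

  stage-suc : ∀ {k a} → suc a ≤ n → Stage k a → Stage (2 + k) (suc a)
  stage-suc {k} {a} 1+a≤n (even , odd) = even′ , odd′
    where
    a≤n : a ≤ n
    a≤n = ℕₚ.<⇒≤ 1+a≤n
    even′ : Reaches (2 + k) (δ (suc a)) (φᵉ (suc a))
    even′ = Reaches-step {k} {p = φᵉ a} {r = map -_ (φᵒ a)} rel even (Reaches-neg {suc k} {p = φᵒ a} odd)
      where
      rel : ∀ i → A· (δ (suc a)) i ≡ A· (δ a) i +ᶻ - δ (n ∸ a) i
      rel i = trans (sym (x+y-y≡x (A· (δ (suc a)) i) (δ (n ∸ a) i)))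
                    (cong (_+ᶻ - δ (n ∸ a) i) (sym (A·δ-step a≤n i)))
    odd′ : Reaches (3 + k) (δ (n ∸ suc a)) (φᵒ (suc a))
    odd′ = Reaches-step {suc k} {p = φᵒ a} {r = φᵉ (suc a)} rel odd even′
      where
      rel : ∀ i → A· (δ (n ∸ suc a)) i ≡ A· (δ (n ∸ a)) i +ᶻ δ (suc a) i
      rel i = trans (A·δ-step (ℕₚ.m∸n≤m n (suc a)) i)
        (cong₂ (λ b b′ → A· (δ b) i +ᶻ δ b′ i)
               (sym (ℕₚ.+-∸-assoc 1 1+a≤n)) (ℕₚ.m∸[m∸n]≡n 1+a≤n))

  stage : ∀ a → a ≤ n → ∃ λ k → Stage k a
  stage zero    _     = 0 , stage-zero
  stage (suc a) 1+a≤n = let (k , s) = stage a (ℕₚ.<⇒≤ 1+a≤n) in 2 + k , stage-suc {k} 1+a≤n s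

  Reaches-repeat : ∀ {k x p p′} → Reaches k x p → Reaches (suc k) x p′ →
    ((0ℤ ∷ p) ⊞ map -_ p′) ⟦A⟧ δ 0 ≈ const 0ℤ
  Reaches-repeat {k} {x} {p} {p′} reach reach′ i i<m = begin
    (((0ℤ ∷ p) ⊞ map -_ p′) ⟦A⟧ e₀) i
      ≡⟨ ⟦A⟧-⊞ (0ℤ ∷ p) (map -_ p′) e₀ i ⟩
    ((0ℤ ∷ p) ⟦A⟧ e₀) i +ᶻ (map -_ p′ ⟦A⟧ e₀) i
      ≡⟨ cong₂ _+ᶻ_ (⟦A⟧-x p e₀ i) (⟦A⟧-neg p′ e₀ i) ⟩
    A· (p ⟦A⟧ e₀) i +ᶻ - (p′ ⟦A⟧ e₀) i
      ≡⟨ cong (_+ᶻ - (p′ ⟦A⟧ e₀) i) (A·-cong (λ j j<m → sym (reach j j<m)) i) ⟩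
    A^ (suc k) x i +ᶻ - (p′ ⟦A⟧ e₀) i
      ≡⟨ cong (_+ᶻ - (p′ ⟦A⟧ e₀) i) (reach′ i i<m) ⟩
    (p′ ⟦A⟧ e₀) i +ᶻ - (p′ ⟦A⟧ e₀) i
      ≡⟨ ℤₚ.+-inverseʳ ((p′ ⟦A⟧ e₀) i) ⟩
    0ℤ ∎
    where
    e₀ : ℕ → ℤ
    e₀ = δ 0

  Annihilator : Set
  Annihilator = ∃ λ q → coeff q 0 ≢ 0ℤ × q ⟦A⟧ δ 0 ≈ const 0ℤ

  -- For n = 2a the walk e₀, eₙ, e₁, eₙ₋₁, … repeats a vector within stage a, for n = 2a + 1
  -- between stage a and stage a + 1.
  annihilator-even : ∀ a → n ≡ a + a → Annihilator
  annihilator-even a n≡a+a =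
    (0ℤ ∷ φᵉ a) ⊞ map -_ (φᵒ a) , nonzero-head (φᵉ a) (φᵒ a) (proj₂ (φ-heads a)) ,
    Reaches-repeat {k} {p = φᵉ a} {p′ = φᵒ a} even odd′
    where
    a≤n : a ≤ n
    a≤n = subst (a ≤_) (sym n≡a+a) (ℕₚ.m≤m+n a a)
    k : ℕ
    k = proj₁ (stage a a≤n)
    even : Reaches k (δ a) (φᵉ a)
    even = proj₁ (proj₂ (stage a a≤n))
    odd′ : Reaches (suc k) (δ a) (φᵒ a)
    odd′ = subst (λ b → Reaches (suc k) (δ b) (φᵒ a))
                 (trans (cong (_∸ a) n≡a+a) (ℕₚ.m+n∸n≡m a a)) (proj₂ (proj₂ (stage a a≤n)))

  annihilator-odd : ∀ a → n ≡ suc (a + a) → Annihilator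
  annihilator-odd a n≡1+a+a =
    (0ℤ ∷ φᵒ a) ⊞ map -_ (φᵉ (suc a)) , nonzero-head (φᵒ a) (φᵉ (suc a)) (proj₁ (φ-heads (suc a))) ,
    Reaches-repeat {suc k} {p = φᵒ a} {p′ = φᵉ (suc a)} odd′ (proj₁ (stage-suc {k} 1+a≤n s))
    where
    1+a≤n : suc a ≤ n
    1+a≤n = subst (suc a ≤_) (sym n≡1+a+a) (s≤s (ℕₚ.m≤m+n a a))
    k : ℕ
    k = proj₁ (stage a (ℕₚ.<⇒≤ 1+a≤n))
    s : Stage k a
    s = proj₂ (stage a (ℕₚ.<⇒≤ 1+a≤n))
    odd′ : Reaches (suc k) (δ (suc a)) (φᵒ a)
    odd′ = subst (λ b → Reaches (suc k) (δ b) (φᵒ a))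
                 (trans (cong (_∸ a) n≡1+a+a)
                        (trans (ℕₚ.+-∸-assoc 1 (ℕₚ.m≤m+n a a)) (cong suc (ℕₚ.m+n∸n≡m a a))))
                 (proj₂ s)

  annihilator : Annihilator
  annihilator = let (a , n≡2a⊎n≡2a+1) = parity n in
    [ annihilator-even a , annihilator-odd a ]′ n≡2a⊎n≡2a+1

  moment : (ℕ → ℤ) → ℕ → ℤ
  moment v k = Σ< m (A^ k v)

  moment-suc : ∀ v k → moment v (suc k) ≡ moment (A· v) k
  moment-suc v k = Σ<-cong m (λ i _ → A^-suc k v i)

  moment-cong : ∀ {v w} → v ≈ w → ∀ k → moment v k ≡ moment w k
  moment-cong v≈w k = Σ<-cong m (A^-cong k v≈w)

  applyRec-moment : ∀ q v s → applyRec q (moment v) s ≡ Σ< m (q ⟦A⟧ A^ s v)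
  applyRec-moment []      v s = sym (Σ<-vanish m (λ _ _ → refl))
  applyRec-moment (a ∷ q) v s = begin
    applyRec (a ∷ q) (moment v) s
      ≡⟨ applyRec-∷ a q (moment v) s ⟩
    a *ᶻ moment v s +ᶻ applyRec q (moment v) (suc s)
      ≡⟨ cong₂ _+ᶻ_ (sym (Σ<-*ˡ m a (A^ s v)))
           (trans (applyRec-moment q v (suc s)) (Σ<-cong m (λ i _ → ⟦A⟧-A· q (A^ s v) i))) ⟩
    Σ< m (λ i → a *ᶻ A^ s v i) +ᶻ Σ< m (A· (q ⟦A⟧ A^ s v))
      ≡⟨ Σ<-distrib-+ m (λ i → a *ᶻ A^ s v i) (A· (q ⟦A⟧ A^ s v)) ⟨
    Σ< m ((a ∷ q) ⟦A⟧ A^ s v) ∎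

  Annihilates-moment : ∀ q v → q ⟦A⟧ v ≈ const 0ℤ → Annihilates q (moment v)
  Annihilates-moment q v qv≈0 s = trans (applyRec-moment q v s)
    (Σ<-vanish m (λ i i<m → trans (A^-⟦A⟧ q s v i) (A^-vanish s qv≈0 i i<m)))

  w₀ : ℕ → ℤ
  w₀ i = δ 0 i - δ 1 i

  A·w₀ : ∀ i → A· w₀ i ≡ δ n i
  A·w₀ i = begin
    A· w₀ i                                   ≡⟨ A·-+ (δ 0) (λ j → - δ 1 j) i ⟩
    A· (δ 0) i +ᶻ A· (λ j → - δ 1 j) i        ≡⟨ cong₂ _+ᶻ_ (A·δ-step z≤n i) (A·-neg (δ 1) i) ⟩
    A· (δ 1) i +ᶻ δ n i +ᶻ - A· (δ 1) i       ≡⟨ xyx⁻¹≈y (A· (δ 1) i) (δ n i) ⟩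
    δ n i                                     ∎

  A·A·w₀ : ∀ i → A· (A· w₀) i ≡ δ 0 i
  A·A·w₀ i = trans (A·-cong (λ j _ → A·w₀ j) i) (A·δ-n i)

  moment-w₀-zero : 0 < n → moment w₀ 0 ≡ 0ℤ
  moment-w₀-zero 0<n = begin
    Σ< m w₀                               ≡⟨ Σ<-distrib-+ m (δ 0) (λ j → - δ 1 j) ⟩
    Σ< m (δ 0) +ᶻ Σ< m (λ j → - δ 1 j)    ≡⟨ cong (Σ< m (δ 0) +ᶻ_) (Σ<-neg m (δ 1)) ⟩
    Σ< m (δ 0) +ᶻ - Σ< m (δ 1)
      ≡⟨ cong₂ (λ x y → x +ᶻ - y) (Σ<-δ {0} {m} (s≤s z≤n)) (Σ<-δ {1} {m} (s≤s 0<n)) ⟩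
    0ℤ                                    ∎

  moment-w₀-one : moment w₀ 1 ≡ 1ℤ
  moment-w₀-one = trans (Σ<-cong m (λ i _ → A·w₀ i)) (Σ<-δ {n} {m} ℕₚ.≤-refl)

  moment-w₀-2+ : ∀ k → moment w₀ (2 + k) ≡ moment (δ 0) k
  moment-w₀-2+ k = begin
    moment w₀ (2 + k)          ≡⟨ moment-suc w₀ (suc k) ⟩
    moment (A· w₀) (suc k)     ≡⟨ moment-suc (A· w₀) k ⟩
    moment (A· (A· w₀)) k      ≡⟨ moment-cong (λ i _ → A·A·w₀ i) k ⟩
    moment (δ 0) k             ∎

  Annihilates-moment-w₀ : ∀ q → q ⟦A⟧ δ 0 ≈ const 0ℤ → Annihilates q (moment w₀)
  Annihilates-moment-w₀ q qe₀≈0 =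
    Annihilates-moment q w₀ (A·-injective {q ⟦A⟧ w₀} (A·-injective {A· (q ⟦A⟧ w₀)} A²qw₀≈0))
    where
    A²qw₀≈0 : A· (A· (q ⟦A⟧ w₀)) ≈ const 0ℤ
    A²qw₀≈0 i i<m = begin
      A· (A· (q ⟦A⟧ w₀)) i     ≡⟨ A·-cong (λ j _ → ⟦A⟧-A· q w₀ j) i ⟨
      A· (q ⟦A⟧ A· w₀) i       ≡⟨ ⟦A⟧-A· q (A· w₀) i ⟨
      (q ⟦A⟧ A· (A· w₀)) i     ≡⟨ ⟦A⟧-cong q (λ j _ → A·A·w₀ j) i i<m ⟩
      (q ⟦A⟧ δ 0) i            ≡⟨ qe₀≈0 i i<m ⟩
      0ℤ                       ∎

  rowSum : ℕ → Fin m → ℕ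
  rowSum k i = ΣFin m (λ j → (A m ^^ k) i j)

  rowSum-suc : ∀ k i → rowSum (suc k) i ≡ ΣFin m (λ l → A m i l ℕ.* rowSum k l)
  rowSum-suc k i = trans (ΣFin-comm m (λ j l → A m i l ℕ.* (A m ^^ k) l j))
    (ΣFin-cong (λ l → ΣFin-*ˡ m (A m i l) (λ j → (A m ^^ k) l j)))

  +rowSum≡A^ : ∀ k i → + rowSum k i ≡ A^ k (const 1ℤ) (toℕ i)
  +rowSum≡A^ zero    i = cong +_ (ΣFin-idMat m i)
  +rowSum≡A^ (suc k) i = begin
    + rowSum (suc k) i
      ≡⟨ cong +_ (rowSum-suc k i) ⟩
    + ΣFin m (λ l → A m i l ℕ.* rowSum k l)
      ≡⟨ +ΣFin≡Σ< m _ _ (λ l → entry (toℕ i + toℕ l ℕ.<ᵇ m) (+rowSum≡A^ k l)) ⟩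
    Σ< m (λ l → if toℕ i + l ℕ.<ᵇ m then A^ k (const 1ℤ) l else 0ℤ)
      ≡⟨ Σ<-if-< (toℕ i) m _ ⟩
    A^ (suc k) (const 1ℤ) (toℕ i) ∎
    where
    entry : ∀ b {r x} → + r ≡ x → + ((if b then 1 else 0) ℕ.* r) ≡ (if b then x else 0ℤ)
    entry true  r≡x = trans (cong +_ (ℕₚ.*-identityˡ _)) r≡x
    entry false _   = refl

  Fcoeff≡moment : ∀ k → Fcoeff n k ≡ moment (δ 0) k
  Fcoeff≡moment zero    = sym (Σ<-δ {0} {m} (s≤s z≤n))
  Fcoeff≡moment (suc k) = begin
    + ΣFin m (rowSum k)          ≡⟨ +ΣFin≡Σ< m (rowSum k) (A^ k (const 1ℤ)) (+rowSum≡A^ k) ⟩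
    moment (const 1ℤ) k          ≡⟨ moment-cong (λ i i<m → sym (A·δ-0 i i<m)) k ⟩
    moment (A· (δ 0)) k          ≡⟨ moment-suc (δ 0) k ⟨
    moment (δ 0) (suc k)         ∎

lemma5p6 : (n : ℕ) → 0 < n →
    (∃₂ λ f g → Represents f g (Fcoeff n))
    × (∀ f g → Represents f g (Fcoeff n) →
         NonZeroSeq (xMulAdd f g)
         × (∀ dg dh → HasDegree (coeff g) dg → HasDegree (xMulAdd f g) dh →
              dh + 2 ≤ dg))
lemma5p6 n 0<n = let (q , q₀≢0 , qe₀≈0) = annihilator in
    rational-of-recurrence q {Fcoeff n} q₀≢0
      (Annihilates-resp q (sym ∘ Fcoeff≡moment) (Annihilates-moment q (δ 0) qe₀≈0))
  , λ f g (g≢0 , conv) →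
      xMulAdd-nonzero f g conv g≢0 , degree-gap q q₀≢0 (Annihilates-moment-w₀ q qe₀≈0) f g conv
  where
  open Operator n
  open ShiftedSeries (Fcoeff n) (moment w₀) (moment-w₀-zero 0<n) moment-w₀-one
    (λ k → trans (Fcoeff≡moment k) (sym (moment-w₀-2+ k)))
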